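{- In the canonical frame, all sections of the Galois dual relations $R', S'$ of the canonical relations $R,S$ are Galois sets.
   Context: Let $\mathcal{L}=(L,\leq,\wedge,\vee,0,1,f,h)$ be a bounded lattice with normal lattice operators $f$ of distribution type $(i_1,\ldots,i_n;1)$ and $h$ of type $(t_1,\ldots,t_n;\partial)$ (an operator of type $(i_1,\ldots,i_n;i_{n+1})$ is a map $\mathcal L^{i_1}\times\cdots\times\mathcal L^{i_n}\to\mathcal L^{i_{n+1}}$ distributing over finite joins in each argument, $\mathcal L^1=\mathcal L$, $\mathcal L^\partial$ the order dual). The canonical frame is $(X,I,Y,R,S)$: $X=Z_1$ the filters, $Y=Z_\partial$ the ideals of $\mathcal L$, $xIy$ iff $x\cap y\neq\emptyset$; Galois maps $U^\perp=\{y\mid \forall x\in U\,xIy\}$, ${}^\perp V=\{x\mid\forall y\in V\,xIy\}$; Galois sets are stable $A={}^\perp(A^\perp)\subseteq X$ or co-stable $B=({}^\perp B)^\perp\subseteq Y$. $\widehat f(\vec u)$ is the filter generated by $\{f(\vec a)\mid a_j\in u_j\}$ and $\widehat h(\vec v)$ the ideal generated by $\{h(\vec a)\mid a_j\in v_j\}$; $xR\vec u$ iff $\widehat f(\vec u)\subseteq x$, $yS\vec v$ iff $\widehat h(\vec v)\subseteq y$. Galois duals: $yR'\vec u$ iff $\forall x\,(xR\vec u\to xIy)$; $xS'\vec v$ iff $\forall y\,(yS\vec v\to xIy)$. Sections are $R'\vec u$, $S'\vec v$ and the sets $yR'\vec u[\_]_k=\{w\mid yR'\vec u[w]_k\}$,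 $xS'\vec v[\_]_k$ obtained by leaving the $k$-th argument place open. -}

module Defs where

open import Level using (Level; _⊔_) renaming (suc to lsuc)
open import Data.Nat using (ℕ)
open import Data.Fin using (Fin; zero; suc)
open import Data.List using (List; foldr)
open import Data.List.Relation.Unary.All using (All)
open import Data.Product using (Σ; _×_)
open import Function.Bundles using (_⇔_)
open import Relation.Binary.PropositionalEquality using (_≡_)
open import Relation.Binary.Lattice.Bundles using (BoundedLattice)

-- Distribution types: 𝟏 stands for L itself, ∂ for its order dual L^∂.
data DType : Set where
  𝟏 ∂ : DType

-- Dependent update of the k-th coordinate of a tuple:  upd u k w  =  u[w]_k
upd : ∀ {a} {n : ℕ} {A : Fin n → Set a} →
      ((j : Fin n) → A j) → (k : Fin n) → A k → (j : Fin n) → A j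
upd u zero    w zero    = w
upd u zero    w (suc j) = u (suc j)
upd u (suc k) w zero    = u zero
upd u (suc k) w (suc j) = upd (λ i → u (suc i)) k w j

module Canonical {c ℓ₁ ℓ₂} (L : BoundedLattice c ℓ₁ ℓ₂) where

  open BoundedLattice L

  ℓ : Level
  ℓ = c ⊔ ℓ₁ ⊔ ℓ₂

  join : DType → Carrier → Carrier → Carrier
  join 𝟏 a b = a ∨ b
  join ∂ a b = a ∧ b

  bot : DType → Carrier
  bot 𝟏 = ⊥
  bot ∂ = ⊤

  -- Normal lattice operators of distribution type (is ; o):
  -- f : L^{i_1} × ... × L^{i_n} → L^o, respecting the lattice equality and
  -- distributing over finite (binary and empty) joins in each argument.

  Op : ℕ → Set c
  Op n = (Fin n → Carrier) → Carrier

  record IsNormalOperator {n : ℕ} (is : Fin n → DType) (o : DType) (f : Op n)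
         : Set (c ⊔ ℓ₁) where
    field
      cong       : ∀ (a b : Fin n → Carrier) → (∀ j → a j ≈ b j) → f a ≈ f b
      distrib    : ∀ (a : Fin n → Carrier) (j : Fin n) (b b′ : Carrier) →
                   f (upd a j (join (is j) b b′))
                     ≈ join o (f (upd a j b)) (f (upd a j b′))
      normal     : ∀ (a : Fin n → Carrier) (j : Fin n) →
                   f (upd a j (bot (is j))) ≈ bot o

  -- Filters and ideals (not required to be proper)

  record Filter : Set (lsuc ℓ) where
    field
      mem    : Carrier → Set ℓ
      top    : mem ⊤
      upward : ∀ {a b} → a ≤ b → mem a → mem b
      meet   : ∀ {a b} → mem a → mem b → mem (a ∧ b)

  record Ideal : Set (lsuc ℓ) where
    field
      mem      : Carrier → Set ℓ
      bottom   : mem ⊥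
      downward : ∀ {a b} → b ≤ a → mem a → mem b
      joins    : ∀ {a b} → mem a → mem b → mem (a ∨ b)


  _∈F_ : Carrier → Filter → Set ℓ
  a ∈F x = Filter.mem x a

  _∈I_ : Carrier → Ideal → Set ℓ
  a ∈I y = Ideal.mem y a

  Z : DType → Set (lsuc ℓ)
  Z 𝟏 = Filter
  Z ∂ = Ideal

  _∈Z_ : ∀ {i} → Carrier → Z i → Set ℓ
  _∈Z_ {𝟏} a u = a ∈F u
  _∈Z_ {∂} a u = a ∈I u

  X Y : Set (lsuc ℓ)
  X = Filter
  Y = Ideal

  _I_ : X → Y → Set ℓ
  x I y = Σ Carrier (λ a → a ∈F x × a ∈I y)

  genFilter : (Carrier → Set ℓ) → Carrier → Set ℓ
  genFilter G a = Σ (List Carrier) (λ bs → All G bs × (foldr _∧_ ⊤ bs ≤ a))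

  genIdeal : (Carrier → Set ℓ) → Carrier → Set ℓ
  genIdeal G a = Σ (List Carrier) (λ bs → All G bs × (a ≤ foldr _∨_ ⊥ bs))

  _⊥′ : ∀ {q} → (X → Set q) → Y → Set (lsuc ℓ ⊔ q)
  (A ⊥′) y = ∀ (x : X) → A x → x I y

  ′⊥_ : ∀ {q} → (Y → Set q) → X → Set (lsuc ℓ ⊔ q)
  (′⊥ B) x = ∀ (y : Y) → B y → x I y

  Stable : ∀ {q} → (X → Set q) → Set (lsuc ℓ ⊔ q)
  Stable A = ∀ (x : X) → A x ⇔ (′⊥ (A ⊥′)) x

  CoStable : ∀ {q} → (Y → Set q) → Set (lsuc ℓ ⊔ q)
  CoStable B = ∀ (y : Y) → B y ⇔ ((′⊥ B) ⊥′) y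

  IsGaloisSet : ∀ {q} (i : DType) → (Z i → Set q) → Set (lsuc ℓ ⊔ q)
  IsGaloisSet 𝟏 A = Stable A
  IsGaloisSet ∂ B = CoStable B

  module Frame {n m : ℕ} (is : Fin n → DType) (ts : Fin m → DType)
               (f : Op n) (h : Op m) where

    fImage : ((j : Fin n) → Z (is j)) → Carrier → Set ℓ
    fImage u b = Σ (Fin n → Carrier) (λ a → (∀ j → a j ∈Z u j) × (f a ≡ b))

    hImage : ((j : Fin m) → Z (ts j)) → Carrier → Set ℓ
    hImage v b = Σ (Fin m → Carrier) (λ a → (∀ j → a j ∈Z v j) × (h a ≡ b))

    R : X → ((j : Fin n) → Z (is j)) → Set ℓ
    R x u = ∀ (a : Carrier) → genFilter (fImage u) a → a ∈F x

    S : Y → ((j : Fin m) → Z (ts j)) → Set ℓ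
    S y v = ∀ (a : Carrier) → genIdeal (hImage v) a → a ∈I y

    R′ : Y → ((j : Fin n) → Z (is j)) → Set (lsuc ℓ)
    R′ y u = ∀ (x : X) → R x u → x I y

    S′ : X → ((j : Fin m) → Z (ts j)) → Set (lsuc ℓ)
    S′ x v = ∀ (y : Y) → S y v → x I y

    R′-section : ((j : Fin n) → Z (is j)) → Y → Set (lsuc ℓ)
    R′-section u y = R′ y u

    S′-section : ((j : Fin m) → Z (ts j)) → X → Set (lsuc ℓ)
    S′-section v x = S′ x v

    R′-section-at : Y → ((j : Fin n) → Z (is j)) → (k : Fin n) → Z (is k) → Set (lsuc ℓ)
    R′-section-at y u k w = R′ y (upd u k w)

    S′-section-at : X → ((j : Fin m) → Z (ts j)) → (k : Fin m) → Z (ts k) → Set (lsuc ℓ)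
    S′-section-at x v k w = S′ x (upd v k w)

-- Both Galois duals are polars: y R′ u says that y meets every x with x R u, so R′(_, u) is the
-- co-stable set R(_, u)^⊥, and dually for S′.  For the k-th sections, the least x with x R u[w]_k
-- is the filter generated by the image of u[w]_k, so y R′ u[w]_k holds iff f(a) ∈ y for some
-- a ∈ u[w]_k.  Let Q be the set of e such that f(a[e]_k) ∈ y for some a agreeing with u off k.
-- Q is an ideal of L^{i_k}: it contains ⊥ by normality, is down-closed by monotonicity, and is
-- closed under joins by distributivity in the k-th place once the two witnesses are met in the
-- other places.  Hence y R′ u[w]_k holds iff w meets Q, i.e. the section is the Galois set ⊥{Q}.

module Submission where

open import Defs
open import Data.Nat using (ℕ)
open import Data.Fin using (Fin)
open import Data.Product using (_×_)
open import Relation.Binary.Lattice.Bundles using (BoundedLattice)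

open import Level using (_⊔_) renaming (suc to lsuc)
open import Data.Fin using (zero; suc)
open import Data.Fin.Properties using (suc-injective)
open import Data.Product using (Σ; _,_)
open import Data.List using (List; []; _∷_; foldr)
open import Data.List.Relation.Unary.All using (All; []; _∷_)
open import Data.Vec.Functional using (tail) renaming (_∷_ to _∷ᶠ_)
open import Function using (_∘_)
open import Function.Bundles using (_⇔_; mk⇔; Equivalence)
open import Function.Construct.Composition using (_⇔-∘_)
open import Relation.Binary.Bundles using (Preorder)
open import Relation.Binary.Structures using (IsPreorder)
open import Relation.Binary.PropositionalEquality using (_≡_; _≢_; refl; cong; subst)
open import Relation.Nullary using (contradiction)

upd-updates : ∀ {a n} {A : Fin n → Set a} (u : ∀ j → A j) (k : Fin n) (w : A k) →
              upd u k w k ≡ w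
upd-updates u zero    w = refl
upd-updates u (suc k) w = upd-updates (λ j → u (suc j)) k w

upd-minimal : ∀ {a n} {A : Fin n → Set a} (u : ∀ j → A j) {j k : Fin n} (w : A k) →
              j ≢ k → upd u k w j ≡ u j
upd-minimal u {zero}  {zero}  w j≢k = contradiction refl j≢k
upd-minimal u {zero}  {suc k} w _   = refl
upd-minimal u {suc j} {zero}  w _   = refl
upd-minimal u {suc j} {suc k} w j≢k = upd-minimal (λ i → u (suc i)) w (j≢k ∘ cong suc)

upd-id : ∀ {a n} {A : Fin n → Set a} (u : ∀ j → A j) (k j : Fin n) → upd u k (u k) j ≡ u j
upd-id u zero    zero    = refl
upd-id u zero    (suc j) = refl
upd-id u (suc k) zero    = refl
upd-id u (suc k) (suc j) = upd-id (λ i → u (suc i)) k j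

upd-pointwise : ∀ {a b r n} {A : Fin n → Set a} {B : Fin n → Set b}
                (R : ∀ j → A j → B j → Set r) {u : ∀ j → A j} {v : ∀ j → B j}
                (k : Fin n) {w : A k} {w′ : B k} →
                (∀ j → j ≢ k → R j (u j) (v j)) → R k w w′ →
                ∀ j → R j (upd u k w j) (upd v k w′ j)
upd-pointwise R zero    off at zero    = at
upd-pointwise R zero    off at (suc j) = off (suc j) λ ()
upd-pointwise R (suc k) off at zero    = off zero λ ()
upd-pointwise R (suc k) off at (suc j) =
  upd-pointwise (λ i → R (suc i)) k (λ i i≢k → off (suc i) (i≢k ∘ suc-injective)) at j

dual : DType → DType
dual 𝟏 = ∂
dual ∂ = 𝟏

module CanonicalFrame {c ℓ₁ ℓ₂} (L : BoundedLattice c ℓ₁ ℓ₂) where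

  open BoundedLattice L hiding (refl)
  open Canonical L

  _≤[_]_ : Carrier → DType → Carrier → Set ℓ₂
  a ≤[ 𝟏 ] b = a ≤ b
  a ≤[ ∂ ] b = b ≤ a

  meet : DType → Carrier → Carrier → Carrier
  meet 𝟏 = _∧_
  meet ∂ = _∨_

  top : DType → Carrier
  top 𝟏 = ⊤
  top ∂ = ⊥

  ≤[]-isPreorder : ∀ i → IsPreorder _≈_ _≤[ i ]_
  ≤[]-isPreorder 𝟏 = isPreorder
  ≤[]-isPreorder ∂ = record
    { isEquivalence = isEquivalence
    ; reflexive     = λ a≈b → reflexive (Eq.sym a≈b)
    ; trans         = λ a≥b b≥c → trans b≥c a≥b
    }

  ≤[]-preorder : DType → Preorder c ℓ₁ ℓ₂
  ≤[]-preorder i = record { isPreorder = ≤[]-isPreorder i }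

  module _ (i : DType) where
    open Preorder (≤[]-preorder i) public
      using () renaming (refl to ≤[]-refl; reflexive to ≤[]-reflexive; trans to ≤[]-trans)

  ≤[]-dual : ∀ i {a b} → a ≤[ i ] b → b ≤[ dual i ] a
  ≤[]-dual 𝟏 a≤b = a≤b
  ≤[]-dual ∂ a≥b = a≥b

  top-maximum : ∀ i a → a ≤[ i ] top i
  top-maximum 𝟏 = maximum
  top-maximum ∂ = minimum

  meet-lowerˡ : ∀ i a b → meet i a b ≤[ i ] a
  meet-lowerˡ 𝟏 = x∧y≤x
  meet-lowerˡ ∂ = x≤x∨y

  meet-lowerʳ : ∀ i a b → meet i a b ≤[ i ] b
  meet-lowerʳ 𝟏 = x∧y≤y
  meet-lowerʳ ∂ = y≤x∨y

  meet-greatest : ∀ i {a b d} → d ≤[ i ] a → d ≤[ i ] b → d ≤[ i ] meet i a b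
  meet-greatest 𝟏 = ∧-greatest
  meet-greatest ∂ = ∨-least

  join-upperˡ : ∀ i a b → a ≤[ i ] join i a b
  join-upperˡ 𝟏 = x≤x∨y
  join-upperˡ ∂ = x∧y≤x

  join-mono : ∀ i {a a′ b b′} → a ≤[ i ] a′ → b ≤[ i ] b′ →
              join i a b ≤[ i ] join i a′ b′
  join-mono 𝟏 a≤a′ b≤b′ = ∨-least (trans a≤a′ (x≤x∨y _ _)) (trans b≤b′ (y≤x∨y _ _))
  join-mono ∂ a≥a′ b≥b′ = ∧-greatest (trans (x∧y≤x _ _) a≥a′) (trans (x∧y≤y _ _) b≥b′)

  join-absorbs : ∀ i {a b} → a ≤[ i ] b → join i a b ≈ b
  join-absorbs 𝟏 a≤b = antisym (∨-least a≤b (≤[]-refl 𝟏)) (y≤x∨y _ _)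
  join-absorbs ∂ a≥b = antisym (x∧y≤y _ _) (∧-greatest a≥b (≤[]-refl ∂))

  _∈[_]_ : Carrier → (i : DType) → Z i → Set ℓ
  a ∈[ i ] w = _∈Z_ {i} a w

  ∈-upward : ∀ i (w : Z i) {a b} → a ≤[ i ] b → a ∈[ i ] w → b ∈[ i ] w
  ∈-upward 𝟏 w = Filter.upward w
  ∈-upward ∂ w = Ideal.downward w

  ∈-top : ∀ i (w : Z i) → top i ∈[ i ] w
  ∈-top 𝟏 w = Filter.top w
  ∈-top ∂ w = Ideal.bottom w

  ∈-meet : ∀ i (w : Z i) {a b} → a ∈[ i ] w → b ∈[ i ] w → meet i a b ∈[ i ] w
  ∈-meet 𝟏 w = Filter.meet w
  ∈-meet ∂ w = Ideal.joins w

  ∈-bot : ∀ i (s : Z (dual i)) → bot i ∈[ dual i ] s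
  ∈-bot 𝟏 s = Ideal.bottom s
  ∈-bot ∂ s = Filter.top s

  ∈-join : ∀ i (s : Z (dual i)) {a b} →
           a ∈[ dual i ] s → b ∈[ dual i ] s → join i a b ∈[ dual i ] s
  ∈-join 𝟏 s = Ideal.joins s
  ∈-join ∂ s = Filter.meet s

  ∈-downward : ∀ i (s : Z (dual i)) {a b} →
               b ≤[ i ] a → a ∈[ dual i ] s → b ∈[ dual i ] s
  ∈-downward i s b≤a = ∈-upward (dual i) s (≤[]-dual i b≤a)

  Meets : ∀ i → Z i → Z (dual i) → Set ℓ
  Meets 𝟏 x y = x I y
  Meets ∂ y x = x I y

  meets⁺ : ∀ i (w : Z i) (z : Z (dual i)) {a} →
           a ∈[ i ] w → a ∈[ dual i ] z → Meets i w z
  meets⁺ 𝟏 x y a∈x a∈y = _ , a∈x , a∈y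
  meets⁺ ∂ y x a∈y a∈x = _ , a∈x , a∈y

  meets⁻ : ∀ i (w : Z i) (z : Z (dual i)) →
           Meets i w z → Σ Carrier (λ a → a ∈[ i ] w × a ∈[ dual i ] z)
  meets⁻ 𝟏 x y (a , a∈x , a∈y) = a , a∈x , a∈y
  meets⁻ ∂ y x (a , a∈x , a∈y) = a , a∈y , a∈x

  record IsFilterOf (i : DType) (P : Carrier → Set ℓ) : Set (c ⊔ ℓ₂ ⊔ ℓ) where
    field
      top∈   : P (top i)
      upward : ∀ {a b} → a ≤[ i ] b → P a → P b
      meet∈  : ∀ {a b} → P a → P b → P (meet i a b)

  record IsIdealOf (i : DType) (Q : Carrier → Set ℓ) : Set (c ⊔ ℓ₂ ⊔ ℓ) where
    field
      bot∈     : Q (bot i)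
      downward : ∀ {a b} → b ≤[ i ] a → Q a → Q b
      join∈    : ∀ {a b} → Q a → Q b → Q (join i a b)

  toZ : ∀ i {P} → IsFilterOf i P → Z i
  toZ 𝟏 {P} P-filter = record { mem = P ; top = top∈ ; upward = upward ; meet = meet∈ }
    where open IsFilterOf P-filter
  toZ ∂ {P} P-filter = record
    { mem = P ; bottom = top∈ ; downward = λ {a} {b} → upward {a} {b} ; joins = meet∈ }
    where open IsFilterOf P-filter

  ∈-toZ⁺ : ∀ i {P} (P-filter : IsFilterOf i P) {a} → P a → a ∈[ i ] toZ i P-filter
  ∈-toZ⁺ 𝟏 _ Pa = Pa
  ∈-toZ⁺ ∂ _ Pa = Pa

  ∈-toZ⁻ : ∀ i {P} (P-filter : IsFilterOf i P) {a} → a ∈[ i ] toZ i P-filter → P a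
  ∈-toZ⁻ 𝟏 _ Pa = Pa
  ∈-toZ⁻ ∂ _ Pa = Pa

  ⊥′-coStable : ∀ {q} (A : X → Set q) → CoStable (A ⊥′)
  ⊥′-coStable A y = mk⇔ (λ y∈A⊥ x x∈⊥A⊥ → x∈⊥A⊥ y y∈A⊥)
                        (λ y∈⊥A⊥⊥ x x∈A → y∈⊥A⊥⊥ x (λ y′ y′∈A⊥ → y′∈A⊥ x x∈A))

  ′⊥-stable : ∀ {q} (B : Y → Set q) → Stable (′⊥ B)
  ′⊥-stable B x = mk⇔ (λ x∈⊥B y y∈⊥B⊥ → y∈⊥B⊥ x x∈⊥B)
                      (λ x∈⊥B⊥⊥ y y∈B → x∈⊥B⊥⊥ y (λ x′ x′∈⊥B → x′∈⊥B y y∈B))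

  isGaloisSet-meeting : ∀ {q} i (P : Z i → Set q) {Q : Carrier → Set ℓ} → IsIdealOf i Q →
                        (∀ w → P w ⇔ Σ Carrier (λ e → e ∈[ i ] w × Q e)) →
                        IsGaloisSet i P
  isGaloisSet-meeting 𝟏 P {Q} Q-ideal P⇔ x =
    mk⇔ (λ Px y y∈P⊥ → y∈P⊥ x Px)
        (λ x∈⊥P⊥ → from (P⇔ x) (x∈⊥P⊥ Qᴵ (λ x′ → to (P⇔ x′))))
    where
      open Equivalence
      open IsIdealOf Q-ideal
      Qᴵ : Ideal
      Qᴵ = record { mem = Q ; bottom = bot∈ ; downward = downward ; joins = join∈ }
  isGaloisSet-meeting ∂ P {Q} Q-ideal P⇔ y =
    mk⇔ (λ Py x x∈⊥P → x∈⊥P y Py) (λ y∈⊥P⊥ → from-Qᶠ (y∈⊥P⊥ Qᶠ Qᶠ-meets))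
    where
      open Equivalence
      open IsIdealOf Q-ideal
      Qᶠ : Filter
      Qᶠ = record
        { mem = Q ; top = bot∈ ; upward = λ {a} {b} → downward {a} {b} ; meet = join∈ }
      Qᶠ-meets : ∀ y′ → P y′ → Qᶠ I y′
      Qᶠ-meets y′ Py′ = let e , e∈y′ , Qe = to (P⇔ y′) Py′ in e , Qe , e∈y′
      from-Qᶠ : Qᶠ I y → P y
      from-Qᶠ (e , Qe , e∈y) = from (P⇔ y) (e , e∈y , Qe)

  polar-isGaloisSet : ∀ {q} o (A : Z o → Set q) →
                      IsGaloisSet (dual o) (λ s → ∀ t → A t → Meets o t s)
  polar-isGaloisSet 𝟏 A = ⊥′-coStable A
  polar-isGaloisSet ∂ A = ′⊥-stable A

  monotone : ∀ {n} (is : Fin n → DType) (o : DType) (g : Op n) →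
             (∀ a b → (∀ j → a j ≈ b j) → g a ≈ g b) →
             (∀ a j {b b′} → b ≤[ is j ] b′ → g (upd a j b) ≤[ o ] g (upd a j b′)) →
             ∀ {a b} → (∀ j → a j ≤[ is j ] b j) → g a ≤[ o ] g b
  monotone {ℕ.zero}  is o g g-cong g-mono₁ _ = ≤[]-reflexive o (g-cong _ _ λ ())
  monotone {ℕ.suc n} is o g g-cong g-mono₁ {a} {b} a≤b = begin
    g a                      ≈⟨ g-cong _ _ (λ { zero → Eq.refl ; (suc _) → Eq.refl }) ⟩
    g (upd a zero (a zero))  ≲⟨ g-mono₁ a zero (a≤b zero) ⟩
    g (upd a zero (b zero))  ≈⟨ g-cong _ _ (λ { zero → Eq.refl ; (suc _) → Eq.refl }) ⟩
    g (b zero ∷ᶠ tail a)     ≲⟨ monotone (is ∘ suc) o (λ t → g (b zero ∷ᶠ t))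
                                  (λ s t s≈t → g-cong _ _ λ { zero → Eq.refl ; (suc j) → s≈t j })
                                  tail-mono₁ (a≤b ∘ suc) ⟩
    g (b zero ∷ᶠ tail b)     ≈⟨ g-cong _ _ (λ { zero → Eq.refl ; (suc _) → Eq.refl }) ⟩
    g b                      ∎
    where
      open import Relation.Binary.Reasoning.Preorder (≤[]-preorder o)
      tail-mono₁ : ∀ t j {c c′} → c ≤[ is (suc j) ] c′ →
                   g (b zero ∷ᶠ upd t j c) ≤[ o ] g (b zero ∷ᶠ upd t j c′)
      tail-mono₁ t j {c} {c′} c≤c′ = begin
        g (b zero ∷ᶠ upd t j c)          ≈⟨ g-cong _ _ (λ { zero → Eq.refl ; (suc _) → Eq.refl }) ⟩
        g (upd (b zero ∷ᶠ t) (suc j) c)  ≲⟨ g-mono₁ (b zero ∷ᶠ t) (suc j) c≤c′ ⟩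
        g (upd (b zero ∷ᶠ t) (suc j) c′) ≈⟨ g-cong _ _ (λ { zero → Eq.refl ; (suc _) → Eq.refl }) ⟩
        g (b zero ∷ᶠ upd t j c′)         ∎

  module NormalOperator {n : ℕ} {is : Fin n → DType} {o : DType} {f : Op n}
                        (f-normal : IsNormalOperator is o f) where

    open IsNormalOperator f-normal renaming (cong to f-cong)
    open import Relation.Binary.Reasoning.Preorder (≤[]-preorder o)

    mono₁ : ∀ a j {b b′} → b ≤[ is j ] b′ → f (upd a j b) ≤[ o ] f (upd a j b′)
    mono₁ a j {b} {b′} b≤b′ = begin
      f (upd a j b)                            ≲⟨ join-upperˡ o _ _ ⟩
      join o (f (upd a j b)) (f (upd a j b′))  ≈⟨ distrib a j b b′ ⟨
      f (upd a j (join (is j) b b′))           ≈⟨ f-cong _ _ (upd-pointwise (λ _ → _≈_) j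
                                                    (λ _ _ → Eq.refl) (join-absorbs (is j) b≤b′)) ⟩
      f (upd a j b′)                           ∎

    mono : ∀ {a b} → (∀ j → a j ≤[ is j ] b j) → f a ≤[ o ] f b
    mono = monotone is o f f-cong mono₁

    _∈ᵛ_ : (Fin n → Carrier) → ((j : Fin n) → Z (is j)) → Set ℓ
    as ∈ᵛ u = ∀ j → as j ∈[ is j ] u j

    Image : ((j : Fin n) → Z (is j)) → Carrier → Set ℓ
    Image u b = Σ (Fin n → Carrier) (λ as → as ∈ᵛ u × f as ≡ b)

    Generated : (Carrier → Set ℓ) → Carrier → Set ℓ
    Generated G a = Σ (List Carrier) (λ bs → All G bs × foldr (meet o) (top o) bs ≤[ o ] a)

    -- The canonical relation (R for o = 𝟏, S for o = ∂) and its Galois dual.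
    Rel : Z o → ((j : Fin n) → Z (is j)) → Set ℓ
    Rel t u = ∀ a → Generated (Image u) a → a ∈[ o ] t

    Rel′ : Z (dual o) → ((j : Fin n) → Z (is j)) → Set (lsuc ℓ)
    Rel′ s u = ∀ t → Rel t u → Meets o t s

    ImageMeets : Z (dual o) → ((j : Fin n) → Z (is j)) → Set ℓ
    ImageMeets s u = Σ (Fin n → Carrier) (λ as → as ∈ᵛ u × f as ∈[ dual o ] s)

    ImageBelow : ((j : Fin n) → Z (is j)) → Carrier → Set ℓ
    ImageBelow u a = Σ (Fin n → Carrier) (λ as → as ∈ᵛ u × f as ≤[ o ] a)

    ImageBelow-isFilter : ∀ u → IsFilterOf o (ImageBelow u)
    ImageBelow-isFilter u = record
      { top∈   = top ∘ is , (λ j → ∈-top (is j) (u j)) , top-maximum o _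
      ; upward = λ { a≤b (as , as∈u , fas≤a) → as , as∈u , ≤[]-trans o fas≤a a≤b }
      ; meet∈  = λ { (as , as∈u , fas≤a) (bs , bs∈u , fbs≤b) →
                     (λ j → meet (is j) (as j) (bs j)) ,
                     (λ j → ∈-meet (is j) (u j) (as∈u j) (bs∈u j)) ,
                     meet-greatest o
                       (≤[]-trans o (mono (λ j → meet-lowerˡ (is j) _ _)) fas≤a)
                       (≤[]-trans o (mono (λ j → meet-lowerʳ (is j) _ _)) fbs≤b) }
      }

    upperImage : ((j : Fin n) → Z (is j)) → Z o
    upperImage u = toZ o (ImageBelow-isFilter u)

    Rel-upperImage : ∀ u → Rel (upperImage u) u
    Rel-upperImage u a (bs , bs⊆Image , ⋀bs≤a) =
      ∈-toZ⁺ o (ImageBelow-isFilter u) (upward ⋀bs≤a (⋀-ImageBelow bs⊆Image))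
      where
        open IsFilterOf (ImageBelow-isFilter u)
        ⋀-ImageBelow : ∀ {bs} → All (Image u) bs → ImageBelow u (foldr (meet o) (top o) bs)
        ⋀-ImageBelow []                          = top∈
        ⋀-ImageBelow ((as , as∈u , refl) ∷ rest) =
          meet∈ (as , as∈u , ≤[]-refl o) (⋀-ImageBelow rest)

    Rel′⇔ImageMeets : ∀ s u → Rel′ s u ⇔ ImageMeets s u
    Rel′⇔ImageMeets s u = mk⇔ to from
      where
        to : Rel′ s u → ImageMeets s u
        to s∈Rel′
          with meets⁻ o (upperImage u) s (s∈Rel′ (upperImage u) (Rel-upperImage u))
        ... | a , a∈f̂u , a∈s with ∈-toZ⁻ o (ImageBelow-isFilter u) a∈f̂u
        ...   | as , as∈u , fas≤a = as , as∈u , ∈-downward o s fas≤a a∈s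
        from : ImageMeets s u → Rel′ s u
        from (as , as∈u , fas∈s) t t∈Rel = meets⁺ o t s (t∈Rel (f as) fas∈gen) fas∈s
          where
            fas∈gen : Generated (Image u) (f as)
            fas∈gen = f as ∷ [] , (as , as∈u , refl) ∷ [] , meet-lowerˡ o _ _

    ImageMeetsAt : Z (dual o) → ((j : Fin n) → Z (is j)) → (k : Fin n) → Carrier → Set ℓ
    ImageMeetsAt s u k e = Σ (Fin n → Carrier) (λ as →
      (∀ j → j ≢ k → as j ∈[ is j ] u j) × f (upd as k e) ∈[ dual o ] s)

    ImageMeetsAt-isIdeal : ∀ s u k → IsIdealOf (is k) (ImageMeetsAt s u k)
    ImageMeetsAt-isIdeal s u k = record
      { bot∈     = top ∘ is , (λ j _ → ∈-top (is j) (u j)) ,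
                   ∈-downward o s (≤[]-reflexive o (normal _ k)) (∈-bot o s)
      ; downward = λ { e′≤e (as , as∈u , f[as,e]∈s) →
                       as , as∈u , ∈-downward o s (mono₁ as k e′≤e) f[as,e]∈s }
      ; join∈    = join∈
      }
      where
        join∈ : ∀ {e₁ e₂} → ImageMeetsAt s u k e₁ → ImageMeetsAt s u k e₂ →
                ImageMeetsAt s u k (join (is k) e₁ e₂)
        join∈ {e₁} {e₂} (as , as∈u , m₁) (bs , bs∈u , m₂) =
          cs , (λ j j≢k → ∈-meet (is j) (u j) (as∈u j j≢k) (bs∈u j j≢k)) ,
          ∈-downward o s bound (∈-join o s m₁ m₂)
          where
            cs : Fin n → Carrier
            cs j = meet (is j) (as j) (bs j)
            cs[e]≤as[e] : ∀ e j → upd cs k e j ≤[ is j ] upd as k e j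
            cs[e]≤as[e] e = upd-pointwise (λ j → _≤[ is j ]_) k
                              (λ j _ → meet-lowerˡ (is j) _ _) (≤[]-refl (is k))
            cs[e]≤bs[e] : ∀ e j → upd cs k e j ≤[ is j ] upd bs k e j
            cs[e]≤bs[e] e = upd-pointwise (λ j → _≤[ is j ]_) k
                              (λ j _ → meet-lowerʳ (is j) _ _) (≤[]-refl (is k))
            bound : f (upd cs k (join (is k) e₁ e₂))
                      ≤[ o ] join o (f (upd as k e₁)) (f (upd bs k e₂))
            bound = begin
              f (upd cs k (join (is k) e₁ e₂))            ≈⟨ distrib cs k e₁ e₂ ⟩
              join o (f (upd cs k e₁)) (f (upd cs k e₂))
                ≲⟨ join-mono o (mono (cs[e]≤as[e] e₁)) (mono (cs[e]≤bs[e] e₂)) ⟩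
              join o (f (upd as k e₁)) (f (upd bs k e₂))  ∎

    ImageMeets-upd⇔ : ∀ s u k w →
      ImageMeets s (upd u k w) ⇔ Σ Carrier (λ e → e ∈[ is k ] w × ImageMeetsAt s u k e)
    ImageMeets-upd⇔ s u k w = mk⇔ to from
      where
        MeetsAt : Set ℓ
        MeetsAt = Σ Carrier (λ e → e ∈[ is k ] w × ImageMeetsAt s u k e)
        to : ImageMeets s (upd u k w) → MeetsAt
        to (as , as∈u[w] , fas∈s) =
          as k , subst (as k ∈[ is k ]_) (upd-updates u k w) (as∈u[w] k) ,
          as , (λ j j≢k → subst (as j ∈[ is j ]_) (upd-minimal u w j≢k) (as∈u[w] j)) ,
          ∈-downward o s (≤[]-reflexive o (f-cong _ _ (Eq.reflexive ∘ upd-id as k))) fas∈s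
        from : MeetsAt → ImageMeets s (upd u k w)
        from (e , e∈w , as , as∈u , f[as,e]∈s) =
          upd as k e , upd-pointwise (λ j → _∈[ is j ]_) k as∈u e∈w , f[as,e]∈s

    Rel′-isGaloisSet : ∀ u → IsGaloisSet (dual o) (λ s → Rel′ s u)
    Rel′-isGaloisSet u = polar-isGaloisSet o (λ t → Rel t u)

    Rel′-section-isGaloisSet : ∀ s u k → IsGaloisSet (is k) (λ w → Rel′ s (upd u k w))
    Rel′-section-isGaloisSet s u k =
      isGaloisSet-meeting (is k) _ (ImageMeetsAt-isIdeal s u k)
        (λ w → ImageMeets-upd⇔ s u k w ⇔-∘ Rel′⇔ImageMeets s (upd u k w))

open CanonicalFrame using (module NormalOperator)

lemma3p5 : ∀ {c ℓ₁ ℓ₂} (L : BoundedLattice c ℓ₁ ℓ₂) {n m : ℕ}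
             (is : Fin n → DType) (ts : Fin m → DType)
             (f : Canonical.Op L n) (h : Canonical.Op L m) →
             Canonical.IsNormalOperator L is 𝟏 f →
             Canonical.IsNormalOperator L ts ∂ h →
             let open Canonical L
                 open Frame is ts f h
             in ((u : (j : Fin n) → Z (is j)) → CoStable (R′-section u))
                × ((v : (j : Fin m) → Z (ts j)) → Stable (S′-section v))
                × ((y : Y) (u : (j : Fin n) → Z (is j)) (k : Fin n) →
                     IsGaloisSet (is k) (R′-section-at y u k))
                × ((x : X) (v : (j : Fin m) → Z (ts j)) (k : Fin m) →
                     IsGaloisSet (ts k) (S′-section-at x v k))
lemma3p5 L is ts f h f-normal h-normal =
  F.Rel′-isGaloisSet , H.Rel′-isGaloisSet ,
  F.Rel′-section-isGaloisSet , H.Rel′-section-isGaloisSet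
  where
    module F = NormalOperator L f-normal
    module H = NormalOperator L h-normal
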